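{- Let $G$ be a connected (finite, simple) graph. Suppose that all the holes in $G$ are pairwise edge-disjoint and that $G$ has exactly one non-edge maximal clique $K$. Then a cycle $C$ in $G$ is a hole if and only if $|V(K)\cap V(C)|\le 2$.
   Context: A hole of a graph is a chordless cycle (a cycle that is an induced subgraph) of length at least $4$. A clique is a complete subgraph; a clique $K$ is called non-edge if $|V(K)|\ge 3$. A maximal clique is a clique not contained in a larger clique. -}

module Defs where

open import Level using (0ℓ)
open import Data.Nat using (ℕ; suc; _≤_; _%_)
open import Data.Nat.DivMod using (m%n<n)
open import Data.Fin using (Fin; toℕ; fromℕ<; _≟_)
open import Data.Fin.Properties using (any?)
open import Data.Fin.Subset using (Subset; _∈_; _⊆_; ∣_∣; _∩_)
open import Data.Vec using (tabulate)
open import Data.Product using (Σ; ∃; _×_; _,_)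
open import Data.Sum using (_⊎_)
open import Relation.Nullary using (¬_; does)
open import Relation.Binary using (Decidable)
open import Relation.Binary.PropositionalEquality using (_≡_; _≢_)
open import Function using (_⇔_)
open import Function.Definitions using (Injective)

record Graph (n : ℕ) : Set₁ where
  field
    Adj    : Fin n → Fin n → Set
    adj?   : Decidable Adj
    sym    : ∀ {u v} → Adj u v → Adj v u
    irrefl : ∀ {u} → ¬ Adj u u

module _ {n : ℕ} (G : Graph n) where
  open Graph G

  data Reach : Fin n → Fin n → Set where
    here : ∀ {u} → Reach u u
    step : ∀ {u v w} → Adj u v → Reach v w → Reach u w

  Connected : Set
  Connected = ∀ u v → Reach u v

  next : ∀ {k} → Fin (suc k) → Fin (suc k)
  next {k} i = fromℕ< (m%n<n (suc (toℕ i)) (suc k))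

  -- A cycle of length suc k ≥ 3: distinct vertices v 0, …, v k with
  -- v i adjacent to v (i+1 mod (suc k)).
  record Cycle : Set where
    field
      k     : ℕ
      2≤k   : 2 ≤ k
      v     : Fin (suc k) → Fin n
      inj   : Injective _≡_ _≡_ v
      edge  : ∀ i → Adj (v i) (v (next i))

  module _ (C : Cycle) where
    open Cycle C

    VertOf : Fin n → Set
    VertOf x = ∃ λ i → v i ≡ x

    VSet : Subset n
    VSet = tabulate (λ x → does (any? (λ i → v i ≟ x)))

    EdgeOf : Fin n → Fin n → Set
    EdgeOf x y = ∃ λ i → (v i ≡ x × v (next i) ≡ y) ⊎ (v i ≡ y × v (next i) ≡ x)

    -- hole: chordless cycle of length ≥ 4 (the only edges of G among
    -- vertices of C are the edges of C)
    IsHole : Set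
    IsHole = 3 ≤ k × (∀ i j → Adj (v i) (v j) → j ≡ next i ⊎ i ≡ next j)

  SameSubgraph : Cycle → Cycle → Set
  SameSubgraph C D = (∀ x → VertOf C x ⇔ VertOf D x)
                   × (∀ x y → EdgeOf C x y ⇔ EdgeOf D x y)

  HolesEdgeDisjoint : Set
  HolesEdgeDisjoint = ∀ H₁ H₂ → IsHole H₁ → IsHole H₂ →
    ∀ x y → EdgeOf H₁ x y → EdgeOf H₂ x y → SameSubgraph H₁ H₂

  IsClique : Subset n → Set
  IsClique K = ∀ x y → x ∈ K → y ∈ K → x ≢ y → Adj x y

  IsMaximalClique : Subset n → Set
  IsMaximalClique K = IsClique K × (∀ K′ → IsClique K′ → K ⊆ K′ → K′ ≡ K)

  -- non-edge maximal clique: maximal clique with at least 3 vertices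
  IsNonEdgeMaxClique : Subset n → Set
  IsNonEdgeMaxClique K = IsMaximalClique K × 3 ≤ ∣ K ∣

  UniqueNonEdgeMaxClique : Subset n → Set
  UniqueNonEdgeMaxClique K =
    IsNonEdgeMaxClique K × (∀ K′ → IsNonEdgeMaxClique K′ → K′ ≡ K)

-- Three vertices of a clique lying on a hole are pairwise adjacent, hence pairwise
-- consecutive on the hole, which is impossible on a cycle of length at least 4.
-- Conversely, argue by induction on the length of a cycle C meeting K in at most
-- two vertices.  A triangle extends to a maximal clique with at least 3 vertices,
-- which must be K, so C is not a triangle.  A chord of C would cut it into two
-- shorter cycles, both meeting K in at most two vertices and hence holes; they
-- share the chord, so edge-disjointness makes them equal, yet the successor of one
-- end of the chord lies on only one of them.
module Submission where

open import Defs
open import Data.Nat using (ℕ; zero; suc; _+_; _*_; _∸_; _≤_; _<_; _≤?_; z≤n; s≤s; s≤s⁻¹; NonZero)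
open import Data.Nat.Properties hiding (_≟_)
open import Data.Nat.DivMod
  using (_%_; _/_; _mod_; m%n<n; m≡m%n+[m/n]*n; %-distribˡ-+; m%n%n≡m%n; [m+n]%n≡m%n; m<n⇒m%n≡m; n%n≡0)
open import Data.Nat.Divisibility using (_∣_; divides; >⇒∤)
open import Data.Fin as Fin using (Fin; zero; suc; toℕ; fromℕ<; _≟_; #_)
open import Data.Fin.Properties using (toℕ-fromℕ<; toℕ-injective; toℕ<n; any?)
  renaming (suc-injective to Fin-suc-injective)
open import Data.Fin.Subset using (Subset; inside; outside; _∈_; _⊆_; ∣_∣; _∩_; _∪_; ⁅_⁆; _-_)
open import Data.Fin.Subset.Properties
  using ( _∈?_; x∈⁅x⁆; x∈⁅y⁆⇒x≡y; x∈p∪q⁺; x∈p∪q⁻; p⊆p∪q; x∈p∩q⁺; x∈p∩q⁻; p⊆q⇒∣p∣≤∣q∣; ⊆-antisym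
        ; x∈p∧x≢y⇒x∈p-y; x∈p⇒∣p-x∣<∣p∣)
open import Data.Vec using (_∷_; here; there)
open import Data.Vec.Properties using (lookup∘tabulate; []=⇒lookup; lookup⇒[]=)
open import Data.List using (List; []; _∷_; allFin)
open import Data.List.Membership.Propositional using () renaming (_∈_ to _∈ˡ_)
open import Data.List.Membership.Propositional.Properties using (∈-allFin)
open import Data.List.Relation.Unary.Any using (here; there)
open import Data.Bool using (T)
open import Data.Product using (Σ; ∃; ∃₂; _×_; _,_; proj₁; proj₂)
open import Data.Sum using (_⊎_; inj₁; inj₂)
open import Data.Empty using (⊥; ⊥-elim)
open import Data.Unit using (tt)
open import Relation.Nullary using (¬_; Dec; yes; no; ¬?; contradiction)
open import Relation.Nullary.Decidable using (_×-dec_; decidable-stable; dec-true; isYes≗does; toWitness)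
open import Relation.Binary using (tri<; tri≈; tri>)
open import Relation.Binary.PropositionalEquality
open import Function using (_∘_; _⇔_; Equivalence; mk⇔)
open import Function.Definitions using (Injective)

%-≡⇒∣∸ : ∀ m n N .{{_ : NonZero N}} → m % N ≡ n % N → N ∣ m ∸ n
%-≡⇒∣∸ m n N eq = divides (m / N ∸ n / N) (begin
  m ∸ n                                     ≡⟨ cong₂ _∸_ (m≡m%n+[m/n]*n m N) (m≡m%n+[m/n]*n n N) ⟩
  (m % N + m / N * N) ∸ (n % N + n / N * N) ≡⟨ cong (λ r → (r + m / N * N) ∸ (n % N + n / N * N)) eq ⟩
  (n % N + m / N * N) ∸ (n % N + n / N * N) ≡⟨ [m+n]∸[m+o]≡n∸o (n % N) _ _ ⟩
  m / N * N ∸ n / N * N                     ≡⟨ *-distribʳ-∸ N (m / N) (n / N) ⟨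
  (m / N ∸ n / N) * N                       ∎)
  where open ≡-Reasoning

∣∧<⇒≡0 : ∀ {m N} → N ∣ m → m < N → m ≡ 0
∣∧<⇒≡0 {zero}  _   _   = refl
∣∧<⇒≡0 {suc m} N∣m m<N = contradiction N∣m (>⇒∤ m<N)

+-%-cancelˡ-≤ : ∀ s {x y N} .{{_ : NonZero N}} → (s + x) % N ≡ (s + y) % N → x < N → x ≤ y
+-%-cancelˡ-≤ s {x} {y} {N} eq x<N =
  m∸n≡0⇒m≤n (∣∧<⇒≡0 N∣x∸y (≤-<-trans (m∸n≤m x y) x<N))
  where
  N∣x∸y : N ∣ x ∸ y
  N∣x∸y = subst (N ∣_) ([m+n]∸[m+o]≡n∸o s x y) (%-≡⇒∣∸ (s + x) (s + y) N eq)

toℕ-mod : ∀ m N .{{_ : NonZero N}} → toℕ (m mod N) ≡ m % N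
toℕ-mod m N = toℕ-fromℕ< (m%n<n m N)

+-mod-cancelˡ : ∀ s {x y N} .{{_ : NonZero N}} → (s + x) mod N ≡ (s + y) mod N → x < N → y < N → x ≡ y
+-mod-cancelˡ s {x} {y} {N} eq x<N y<N =
  ≤-antisym (+-%-cancelˡ-≤ s eq′ x<N) (+-%-cancelˡ-≤ s (sym eq′) y<N)
  where
  eq′ : (s + x) % N ≡ (s + y) % N
  eq′ = trans (sym (toℕ-mod (s + x) N)) (trans (cong toℕ eq) (toℕ-mod (s + y) N))

%-≡⇒mod-≡ : ∀ {m m′} N .{{_ : NonZero N}} → m % N ≡ m′ % N → m mod N ≡ m′ mod N
%-≡⇒mod-≡ {m} {m′} N eq = toℕ-injective (trans (toℕ-mod m N) (trans eq (sym (toℕ-mod m′ N))))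

toℕ-mod-inverse : ∀ {N} .{{_ : NonZero N}} (i : Fin N) → toℕ i mod N ≡ i
toℕ-mod-inverse {N} i = toℕ-injective (trans (toℕ-mod (toℕ i) N) (m<n⇒m%n≡m (toℕ<n i)))

suc-toℕ-mod : ∀ m N .{{_ : NonZero N}} → suc (toℕ (m mod N)) mod N ≡ suc m mod N
suc-toℕ-mod m N = %-≡⇒mod-≡ N (begin
  (1 + toℕ (m mod N)) % N      ≡⟨ cong (λ r → (1 + r) % N) (toℕ-mod m N) ⟩
  (1 + m % N) % N              ≡⟨ %-distribˡ-+ 1 (m % N) N ⟩
  (1 % N + m % N % N) % N      ≡⟨ cong (λ r → (1 % N + r) % N) (m%n%n≡m%n m N) ⟩
  (1 % N + m % N) % N          ≡⟨ %-distribˡ-+ 1 m N ⟨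
  (1 + m) % N                  ∎)
  where open ≡-Reasoning

mod-periodic : ∀ m N .{{_ : NonZero N}} → (m + N) mod N ≡ m mod N
mod-periodic m N = %-≡⇒mod-≡ N ([m+n]%n≡m%n m N)

m+n≡1+o∧2≤n⇒m<o : ∀ {m n o} → m + n ≡ suc o → 2 ≤ n → m < o
m+n≡1+o∧2≤n⇒m<o {m} {n} {o} m+n≡1+o 2≤n = s≤s⁻¹ (begin
  suc (suc m) ≡⟨ +-comm 2 m ⟩
  m + 2       ≤⟨ +-monoʳ-≤ m 2≤n ⟩
  m + n       ≡⟨ m+n≡1+o ⟩
  suc o       ∎)
  where open ≤-Reasoning

gap≥2 : ∀ {m n} → m < n → n ≢ suc m → ∃ λ c → m + suc (suc c) ≡ n
gap≥2 {m} m<n n≢1+m with m≤n⇒∃[o]m+o≡n m<n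
... | zero  , 1+m+0≡n = contradiction (trans (sym 1+m+0≡n) (+-identityʳ (suc m))) n≢1+m
... | suc c , 1+m+1+c≡n = c , trans (+-suc m (suc c)) 1+m+1+c≡n

module _ {n : ℕ} {p : Subset n} where

  x,y,z∈p⇒3≤∣p∣ : ∀ {x y z} → x ≢ y → x ≢ z → y ≢ z → x ∈ p → y ∈ p → z ∈ p → 3 ≤ ∣ p ∣
  x,y,z∈p⇒3≤∣p∣ {x} {y} {z} x≢y x≢z y≢z x∈p y∈p z∈p = ≤-trans (s≤s 2≤∣p-x∣) (x∈p⇒∣p-x∣<∣p∣ x∈p)
    where
    y∈p-x = x∈p∧x≢y⇒x∈p-y y∈p (x≢y ∘ sym)
    z∈p-x-y = x∈p∧x≢y⇒x∈p-y (x∈p∧x≢y⇒x∈p-y z∈p (x≢z ∘ sym)) (y≢z ∘ sym)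
    2≤∣p-x∣ : 2 ≤ ∣ p - x ∣
    2≤∣p-x∣ = ≤-trans (s≤s (≤-trans (s≤s z≤n) (x∈p⇒∣p-x∣<∣p∣ z∈p-x-y))) (x∈p⇒∣p-x∣<∣p∣ y∈p-x)

m≤∣p∣⇒injection : ∀ {n m} (p : Subset n) → m ≤ ∣ p ∣ →
  Σ (Fin m → Fin n) λ f → Injective _≡_ _≡_ f × (∀ i → f i ∈ p)
m≤∣p∣⇒injection {m = zero} p _ = (λ ()) , (λ { {()} }) , λ ()
m≤∣p∣⇒injection {m = suc m} (inside ∷ p) (s≤s m≤∣p∣) with m≤∣p∣⇒injection p m≤∣p∣
... | f , f-inj , f∈p = g , g-inj , g∈
  where
  g : Fin (suc m) → _
  g zero = zero
  g (suc i) = suc (f i)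
  g-inj : Injective _≡_ _≡_ g
  g-inj {zero} {zero} _ = refl
  g-inj {suc i} {suc j} e = cong suc (f-inj (Fin-suc-injective e))
  g∈ : ∀ i → g i ∈ inside ∷ p
  g∈ zero = here
  g∈ (suc i) = there (f∈p i)
m≤∣p∣⇒injection {m = suc m} (outside ∷ p) m≤∣p∣ with m≤∣p∣⇒injection p m≤∣p∣
... | f , f-inj , f∈p = (λ i → suc (f i)) , (λ e → f-inj (Fin-suc-injective e)) , (λ i → there (f∈p i))

module _ {n : ℕ} (G : Graph n) where
  open Graph G renaming (sym to adj-sym)

  NonNeighbourIn : Subset n → Fin n → Set
  NonNeighbourIn S x = ∃ λ y → y ∈ S × y ≢ x × ¬ Adj x y

  nonNeighbourIn? : ∀ S x → Dec (NonNeighbourIn S x)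
  nonNeighbourIn? S x = any? λ y → y ∈? S ×-dec ¬? (y ≟ x) ×-dec ¬? (adj? x y)

  Settled : Subset n → Fin n → Set
  Settled S x = x ∈ S ⊎ NonNeighbourIn S x

  Settled-mono : ∀ {S T : Subset n} {x} → S ⊆ T → Settled S x → Settled T x
  Settled-mono S⊆T (inj₁ x∈S) = inj₁ (S⊆T x∈S)
  Settled-mono S⊆T (inj₂ (y , y∈S , y≢x , ¬adj)) = inj₂ (y , S⊆T y∈S , y≢x , ¬adj)

  insert : (S : Subset n) (x : Fin n) → Dec (NonNeighbourIn S x) → Subset n
  insert S x (yes _) = S
  insert S x (no _)  = S ∪ ⁅ x ⁆

  ⊆-insert : ∀ S x (d : Dec (NonNeighbourIn S x)) → S ⊆ insert S x d
  ⊆-insert S x (yes _) = λ y∈S → y∈S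
  ⊆-insert S x (no _)  = p⊆p∪q ⁅ x ⁆

  insert-settled : ∀ S x (d : Dec (NonNeighbourIn S x)) → Settled (insert S x d) x
  insert-settled S x (yes nn) = inj₂ nn
  insert-settled S x (no _)   = inj₁ (x∈p∪q⁺ (inj₂ (x∈⁅x⁆ x)))

  y∈S∪⁅x⁆⁻ : ∀ {S : Subset n} {x y} → y ∈ S ∪ ⁅ x ⁆ → y ∈ S ⊎ y ≡ x
  y∈S∪⁅x⁆⁻ {S} {x} y∈ with x∈p∪q⁻ S ⁅ x ⁆ y∈
  ... | inj₁ y∈S = inj₁ y∈S
  ... | inj₂ y∈x = inj₂ (x∈⁅y⁆⇒x≡y x y∈x)

  ¬NonNeighbourIn⇒Adj : ∀ {S : Subset n} {x y} → ¬ NonNeighbourIn S x → y ∈ S → y ≢ x → Adj x y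
  ¬NonNeighbourIn⇒Adj {x = x} {y} ¬nn y∈S y≢x =
    decidable-stable (adj? x y) λ ¬adj → ¬nn (y , y∈S , y≢x , ¬adj)

  insert-isClique : ∀ S x (d : Dec (NonNeighbourIn S x)) → IsClique G S → IsClique G (insert S x d)
  insert-isClique S x (yes _) S-clique = S-clique
  insert-isClique S x (no ¬nn) S-clique a b a∈ b∈ =
    adjacent (y∈S∪⁅x⁆⁻ {S} a∈) (y∈S∪⁅x⁆⁻ {S} b∈)
    where
    adjacent : ∀ {a b} → a ∈ S ⊎ a ≡ x → b ∈ S ⊎ b ≡ x → a ≢ b → Adj a b
    adjacent (inj₁ a∈S) (inj₁ b∈S) a≢b = S-clique _ _ a∈S b∈S a≢b
    adjacent (inj₁ a∈S) (inj₂ refl) a≢b = adj-sym (¬NonNeighbourIn⇒Adj ¬nn a∈S a≢b)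
    adjacent (inj₂ refl) (inj₁ b∈S) a≢b = ¬NonNeighbourIn⇒Adj ¬nn b∈S (a≢b ∘ sym)
    adjacent (inj₂ refl) (inj₂ refl) a≢b = contradiction refl a≢b

  greedy : Subset n → List (Fin n) → Subset n
  greedy S []       = S
  greedy S (x ∷ xs) = greedy (insert S x (nonNeighbourIn? S x)) xs

  ⊆-greedy : ∀ S xs → S ⊆ greedy S xs
  ⊆-greedy S []       = λ y∈S → y∈S
  ⊆-greedy S (x ∷ xs) = ⊆-greedy _ xs ∘ ⊆-insert S x (nonNeighbourIn? S x)

  greedy-isClique : ∀ S xs → IsClique G S → IsClique G (greedy S xs)
  greedy-isClique S []       = λ S-clique → S-clique
  greedy-isClique S (x ∷ xs) = greedy-isClique _ xs ∘ insert-isClique S x (nonNeighbourIn? S x)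

  greedy-settled : ∀ S {x} xs → x ∈ˡ xs → Settled (greedy S xs) x
  greedy-settled S (x ∷ xs) (here refl) =
    Settled-mono (⊆-greedy _ xs) (insert-settled S x (nonNeighbourIn? S x))
  greedy-settled S (x ∷ xs) (there x∈xs) = greedy-settled _ xs x∈xs

  settled⇒maximal : ∀ {M} → IsClique G M → (∀ x → Settled M x) → IsMaximalClique G M
  settled⇒maximal {M} M-clique settled =
    M-clique , λ K′ K′-clique M⊆K′ → ⊆-antisym (K′⊆M K′-clique M⊆K′) M⊆K′
    where
    K′⊆M : ∀ {K′} → IsClique G K′ → M ⊆ K′ → K′ ⊆ M
    K′⊆M K′-clique M⊆K′ {x} x∈K′ with settled x
    ... | inj₁ x∈M = x∈M
    ... | inj₂ (y , y∈M , y≢x , ¬adj) = contradiction (K′-clique x y x∈K′ (M⊆K′ y∈M) (y≢x ∘ sym)) ¬adj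

  ⊆-maximalClique : ∀ {S} → IsClique G S → ∃ λ M → S ⊆ M × IsMaximalClique G M
  ⊆-maximalClique {S} S-clique =
    greedy S (allFin n) , ⊆-greedy S (allFin n) ,
    settled⇒maximal (greedy-isClique S (allFin n) S-clique) (λ x → greedy-settled S (allFin n) (∈-allFin x))

  triangle : Fin n → Fin n → Fin n → Subset n
  triangle x y z = ⁅ x ⁆ ∪ ⁅ y ⁆ ∪ ⁅ z ⁆

  module _ {x y z : Fin n} where

    x∈triangle : x ∈ triangle x y z
    x∈triangle = x∈p∪q⁺ (inj₁ (x∈⁅x⁆ x))

    y∈triangle : y ∈ triangle x y z
    y∈triangle = x∈p∪q⁺ (inj₂ (x∈p∪q⁺ (inj₁ (x∈⁅x⁆ y))))

    z∈triangle : z ∈ triangle x y z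
    z∈triangle = x∈p∪q⁺ (inj₂ (x∈p∪q⁺ (inj₂ (x∈⁅x⁆ z))))

    ∈triangle⁻ : ∀ {a} → a ∈ triangle x y z → a ≡ x ⊎ a ≡ y ⊎ a ≡ z
    ∈triangle⁻ a∈ with x∈p∪q⁻ ⁅ x ⁆ _ a∈
    ... | inj₁ a∈x = inj₁ (x∈⁅y⁆⇒x≡y x a∈x)
    ... | inj₂ a∈yz with x∈p∪q⁻ ⁅ y ⁆ ⁅ z ⁆ a∈yz
    ...   | inj₁ a∈y = inj₂ (inj₁ (x∈⁅y⁆⇒x≡y y a∈y))
    ...   | inj₂ a∈z = inj₂ (inj₂ (x∈⁅y⁆⇒x≡y z a∈z))

    triangle-isClique : Adj x y → Adj y z → Adj x z → IsClique G (triangle x y z)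
    triangle-isClique xy yz xz a b a∈ b∈ = adjacent (∈triangle⁻ a∈) (∈triangle⁻ b∈)
      where
      adjacent : ∀ {a b} → a ≡ x ⊎ a ≡ y ⊎ a ≡ z → b ≡ x ⊎ b ≡ y ⊎ b ≡ z → a ≢ b → Adj a b
      adjacent (inj₁ refl)        (inj₂ (inj₁ refl)) _ = xy
      adjacent (inj₁ refl)        (inj₂ (inj₂ refl)) _ = xz
      adjacent (inj₂ (inj₁ refl)) (inj₁ refl)        _ = adj-sym xy
      adjacent (inj₂ (inj₁ refl)) (inj₂ (inj₂ refl)) _ = yz
      adjacent (inj₂ (inj₂ refl)) (inj₁ refl)        _ = adj-sym xz
      adjacent (inj₂ (inj₂ refl)) (inj₂ (inj₁ refl)) _ = adj-sym yz
      adjacent (inj₁ refl)        (inj₁ refl)        a≢a = contradiction refl a≢a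
      adjacent (inj₂ (inj₁ refl)) (inj₂ (inj₁ refl)) a≢a = contradiction refl a≢a
      adjacent (inj₂ (inj₂ refl)) (inj₂ (inj₂ refl)) a≢a = contradiction refl a≢a

  module _ {K : Subset n} (unique : UniqueNonEdgeMaxClique G K) where

    bigClique⊆K : ∀ {S} → IsClique G S → 3 ≤ ∣ S ∣ → S ⊆ K
    bigClique⊆K {S} S-clique 3≤∣S∣ with ⊆-maximalClique S-clique
    ... | M , S⊆M , M-maximal = subst (S ⊆_) M≡K S⊆M
      where
      M≡K : M ≡ K
      M≡K = proj₂ unique M (M-maximal , ≤-trans 3≤∣S∣ (p⊆q⇒∣p∣≤∣q∣ S⊆M))

    triangle⊆K : ∀ {x y z} → x ≢ y → x ≢ z → y ≢ z → Adj x y → Adj y z → Adj x z →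
      x ∈ K × y ∈ K × z ∈ K
    triangle⊆K x≢y x≢z y≢z xy yz xz =
      T⊆K x∈triangle , T⊆K y∈triangle , T⊆K z∈triangle
      where
      T⊆K = bigClique⊆K (triangle-isClique xy yz xz)
              (x,y,z∈p⇒3≤∣p∣ x≢y x≢z y≢z x∈triangle y∈triangle z∈triangle)

  VertOf⇒∈VSet : ∀ C {x} → VertOf G C x → x ∈ VSet G C
  VertOf⇒∈VSet C {x} x∈C =
    lookup⇒[]= x _ (trans (lookup∘tabulate _ x) (dec-true (any? (λ i → Cycle.v C i ≟ x)) x∈C))

  ∈VSet⇒VertOf : ∀ C {x} → x ∈ VSet G C → VertOf G C x
  ∈VSet⇒VertOf C {x} x∈C = toWitness (subst T (sym does≡true) tt)
    where
    x∈C? = any? (λ i → Cycle.v C i ≟ x)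
    does≡true = trans (isYes≗does x∈C?) (trans (sym (lookup∘tabulate _ x)) ([]=⇒lookup x∈C))

  ∣∩VSet∣-mono : ∀ S C D → (∀ x → VertOf G D x → VertOf G C x) → ∣ S ∩ VSet G D ∣ ≤ ∣ S ∩ VSet G C ∣
  ∣∩VSet∣-mono S C D D⊆C = p⊆q⇒∣p∣≤∣q∣ λ {x} x∈ →
    let x∈S , x∈D = x∈p∩q⁻ S _ x∈ in x∈p∩q⁺ (x∈S , VertOf⇒∈VSet C (D⊆C x (∈VSet⇒VertOf D x∈D)))

  EdgeOf-sym : ∀ C {x y} → EdgeOf G C x y → EdgeOf G C y x
  EdgeOf-sym C (i , inj₁ e) = i , inj₂ e
  EdgeOf-sym C (i , inj₂ e) = i , inj₁ e

  module _ {k : ℕ} where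

    next-injective : ∀ {i j : Fin (suc k)} → next G i ≡ next G j → i ≡ j
    next-injective {i} {j} eq = toℕ-injective (+-mod-cancelˡ 1 eq (toℕ<n i) (toℕ<n j))

    toℕ-next-< : ∀ {i : Fin (suc k)} → toℕ i < k → toℕ (next G i) ≡ suc (toℕ i)
    toℕ-next-< {i} i<k = trans (toℕ-mod (suc (toℕ i)) (suc k)) (m<n⇒m%n≡m (s≤s i<k))

    toℕ-next-last : ∀ {i : Fin (suc k)} → toℕ i ≡ k → toℕ (next G i) ≡ 0
    toℕ-next-last {i} i≡k =
      trans (toℕ-mod (suc (toℕ i)) (suc k)) (trans (cong (λ m → suc m % suc k) i≡k) (n%n≡0 (suc k)))

    next³≢id : 3 ≤ k → ∀ (i : Fin (suc k)) → next G (next G (next G i)) ≢ i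
    next³≢id 3≤k i eq = contradiction (+-mod-cancelˡ (toℕ i) loop (s≤s z≤n) (s≤s 3≤k)) λ ()
      where
      open ≡-Reasoning
      loop : (toℕ i + 0) mod suc k ≡ (toℕ i + 3) mod suc k
      loop = begin
        (toℕ i + 0) mod suc k                             ≡⟨ cong (_mod suc k) (+-identityʳ (toℕ i)) ⟩
        toℕ i mod suc k                                   ≡⟨ toℕ-mod-inverse i ⟩
        i                                                 ≡⟨ eq ⟨
        next G (next G (next G i))                        ≡⟨ cong (λ j → suc (toℕ j) mod suc k)
                                                               (suc-toℕ-mod (suc (toℕ i)) (suc k)) ⟩
        suc (toℕ (suc (suc (toℕ i)) mod suc k)) mod suc k ≡⟨ suc-toℕ-mod (suc (suc (toℕ i))) (suc k) ⟩
        (3 + toℕ i) mod suc k                             ≡⟨ cong (_mod suc k) (+-comm 3 (toℕ i)) ⟩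
        (toℕ i + 3) mod suc k                             ∎

    toℕ≡suc⇒≡next : ∀ {i j : Fin (suc k)} → toℕ j ≡ suc (toℕ i) → j ≡ next G i
    toℕ≡suc⇒≡next {i} {j} eq = trans (sym (toℕ-mod-inverse j)) (cong (_mod suc k) eq)

    toℕ+1+k≡suc⇒≡next : ∀ {i j : Fin (suc k)} → toℕ i + suc k ≡ suc (toℕ j) → i ≡ next G j
    toℕ+1+k≡suc⇒≡next {i} {j} eq =
      trans (sym (toℕ-mod-inverse i)) (trans (sym (mod-periodic (toℕ i) (suc k))) (cong (_mod suc k) eq))

    Consecutive : Fin (suc k) → Fin (suc k) → Set
    Consecutive i j = j ≡ next G i ⊎ i ≡ next G j

    ¬consecutive-triangle : 3 ≤ k → ∀ {i j l} → i ≢ j → i ≢ l → j ≢ l →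
      Consecutive i j → Consecutive i l → Consecutive j l → ⊥
    ¬consecutive-triangle _ _ _ j≢l (inj₁ j=i⁺) (inj₁ l=i⁺) _ = j≢l (trans j=i⁺ (sym l=i⁺))
    ¬consecutive-triangle _ i≢j _ _ (inj₁ _) (inj₂ i=l⁺) (inj₂ j=l⁺) = i≢j (trans i=l⁺ (sym j=l⁺))
    ¬consecutive-triangle _ i≢j _ _ (inj₂ _) (inj₁ l=i⁺) (inj₁ l=j⁺) = i≢j (next-injective (trans (sym l=i⁺) l=j⁺))
    ¬consecutive-triangle _ _ _ j≢l (inj₂ i=j⁺) (inj₂ i=l⁺) _ = j≢l (next-injective (trans (sym i=j⁺) i=l⁺))
    ¬consecutive-triangle 3≤k _ _ _ (inj₁ j=i⁺) (inj₂ i=l⁺) (inj₁ l=j⁺) =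
      next³≢id 3≤k _ (sym (trans i=l⁺ (cong (next G) (trans l=j⁺ (cong (next G) j=i⁺)))))
    ¬consecutive-triangle 3≤k _ _ _ (inj₂ i=j⁺) (inj₁ l=i⁺) (inj₂ j=l⁺) =
      next³≢id 3≤k _ (sym (trans i=j⁺ (cong (next G) (trans j=l⁺ (cong (next G) l=i⁺)))))

  module ClosedPath (d : ℕ) (2≤d : 2 ≤ d) (u : ℕ → Fin n)
    (u-injective : ∀ {s t} → s ≤ d → t ≤ d → u s ≡ u t → s ≡ t)
    (u-step : ∀ t → t < d → Adj (u t) (u (suc t)))
    (u-close : Adj (u d) (u 0)) where

    private
      toℕ≤d : (t : Fin (suc d)) → toℕ t ≤ d
      toℕ≤d t = s≤s⁻¹ (toℕ<n t)

      last : Fin (suc d)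
      last = fromℕ< (n<1+n d)

      edge : ∀ t → Adj (u (toℕ t)) (u (toℕ (next G t)))
      edge t with m≤n⇒m<n∨m≡n (toℕ≤d t)
      ... | inj₁ t<d = subst (Adj (u (toℕ t)) ∘ u) (sym (toℕ-next-< t<d)) (u-step (toℕ t) t<d)
      ... | inj₂ t≡d = subst₂ (λ a b → Adj (u a) (u b)) (sym t≡d) (sym (toℕ-next-last t≡d)) u-close

    cycle : Cycle G
    cycle = record
      { k = d ; 2≤k = 2≤d ; v = u ∘ toℕ
      ; inj = λ {s} {t} eq → toℕ-injective (u-injective (toℕ≤d s) (toℕ≤d t) eq)
      ; edge = edge }

    VertOf-cycle⁻ : ∀ {x} → VertOf G cycle x → ∃ λ t → t ≤ d × u t ≡ x
    VertOf-cycle⁻ (t , ut≡x) = toℕ t , toℕ≤d t , ut≡x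

    VertOf-cycle⁺ : ∀ {t} → t ≤ d → VertOf G cycle (u t)
    VertOf-cycle⁺ t≤d = fromℕ< (s≤s t≤d) , cong u (toℕ-fromℕ< (s≤s t≤d))

    closing-edge : EdgeOf G cycle (u d) (u 0)
    closing-edge =
      last , inj₁ (cong u (toℕ-fromℕ< (n<1+n d)) , cong u (toℕ-next-last (toℕ-fromℕ< (n<1+n d))))

  record ChordSplit (C : Cycle G) : Set where
    field
      left right    : Cycle G
      left-shorter  : Cycle.k left < Cycle.k C
      right-shorter : Cycle.k right < Cycle.k C
      left-⊆        : ∀ x → VertOf G left x → VertOf G C x
      right-⊆       : ∀ x → VertOf G right x → VertOf G C x
      shared-edge   : ∃₂ λ x y → EdgeOf G left x y × EdgeOf G right x y
      left-only     : ∃ λ x → VertOf G left x × ¬ VertOf G right x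

  ¬hole-split : HolesEdgeDisjoint G → ∀ {C} (split : ChordSplit C) →
    IsHole G (ChordSplit.left split) → IsHole G (ChordSplit.right split) → ⊥
  ¬hole-split holes-disjoint split left-hole right-hole =
    let x , y , x–y∈L , x–y∈R = shared-edge
        z , z∈L , z∉R = left-only
        L≅R = holes-disjoint left right left-hole right-hole x y x–y∈L x–y∈R
    in z∉R (Equivalence.to (proj₁ L≅R z) z∈L)
    where open ChordSplit split

  module OnCycle (C : Cycle G) where
    open Cycle C

    vertexAt : ℕ → Fin n
    vertexAt m = v (m mod suc k)

    vertexAt-toℕ : ∀ i → vertexAt (toℕ i) ≡ v i
    vertexAt-toℕ i = cong v (toℕ-mod-inverse i)

    vertexAt-edge : ∀ m → Adj (vertexAt m) (vertexAt (suc m))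
    vertexAt-edge m = subst (Adj (vertexAt m) ∘ v) (suc-toℕ-mod m (suc k)) (edge (m mod suc k))

    vertexAt-periodic : ∀ m → vertexAt (m + suc k) ≡ vertexAt m
    vertexAt-periodic m = cong v (mod-periodic m (suc k))

    vertexAt-cancelˡ : ∀ s {x y} → x ≤ k → y ≤ k → vertexAt (s + x) ≡ vertexAt (s + y) → x ≡ y
    vertexAt-cancelˡ s x≤k y≤k eq = +-mod-cancelˡ s (inj eq) (s≤s x≤k) (s≤s y≤k)

    vertexAt∈C : ∀ m → VertOf G C (vertexAt m)
    vertexAt∈C m = m mod suc k , refl

    module Arc (s d : ℕ) (2≤d : 2 ≤ d) (d≤k : d ≤ k) (chord : Adj (vertexAt (s + d)) (vertexAt s)) where
      open ClosedPath d 2≤d (λ t → vertexAt (s + t))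
        (λ x≤d y≤d → vertexAt-cancelˡ s (≤-trans x≤d d≤k) (≤-trans y≤d d≤k))
        (λ t _ → subst (Adj (vertexAt (s + t)) ∘ vertexAt) (sym (+-suc s t)) (vertexAt-edge (s + t)))
        (subst (Adj (vertexAt (s + d)) ∘ vertexAt) (sym (+-identityʳ s)) chord)
        public

      cycle⊆C : ∀ x → VertOf G cycle x → VertOf G C x
      cycle⊆C x x∈ = let t , _ , eq = VertOf-cycle⁻ x∈ in subst (VertOf G C) eq (vertexAt∈C (s + t))

    -- The chord joins positions a and a + d, where d = c + 2 and d + e = k + 1.  The two arcs
    -- a, …, a + d and a + d, …, a + d + e are closed by the chord; a + 1 lies on the first only.
    chordSplit : ∀ a c e → suc (suc c) + e ≡ suc k → 2 ≤ e →
      Adj (vertexAt (a + suc (suc c))) (vertexAt a) → ChordSplit C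
    chordSplit a c e d+e≡1+k 2≤e chord = record
      { left = L.cycle ; right = R.cycle
      ; left-shorter = d<k ; right-shorter = e<k
      ; left-⊆ = L.cycle⊆C ; right-⊆ = R.cycle⊆C
      ; shared-edge = vertexAt (a + d) , vertexAt a , left-chord , right-chord
      ; left-only = vertexAt (a + 1) , L.VertOf-cycle⁺ (s≤s z≤n) , ∉right }
      where
      d = suc (suc c)
      d<k : d < k
      d<k = m+n≡1+o∧2≤n⇒m<o d+e≡1+k 2≤e
      e<k : e < k
      e<k = m+n≡1+o∧2≤n⇒m<o (trans (+-comm e d) d+e≡1+k) (s≤s (s≤s z≤n))
      wrap : vertexAt (a + d + e) ≡ vertexAt a
      wrap = trans (cong vertexAt (trans (+-assoc a d e) (cong (a +_) d+e≡1+k))) (vertexAt-periodic a)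
      module L = Arc a d (s≤s (s≤s z≤n)) (<⇒≤ d<k) chord
      module R = Arc (a + d) e 2≤e (<⇒≤ e<k)
        (subst (λ x → Adj x (vertexAt (a + d))) (sym wrap) (adj-sym chord))
      left-chord : EdgeOf G L.cycle (vertexAt (a + d)) (vertexAt a)
      left-chord = subst (EdgeOf G L.cycle (vertexAt (a + d)) ∘ vertexAt) (+-identityʳ a) L.closing-edge
      right-chord : EdgeOf G R.cycle (vertexAt (a + d)) (vertexAt a)
      right-chord = EdgeOf-sym R.cycle
        (subst₂ (EdgeOf G R.cycle) wrap (cong vertexAt (+-identityʳ (a + d))) R.closing-edge)
      ∉right : ¬ VertOf G R.cycle (vertexAt (a + 1))
      ∉right x∈ with R.VertOf-cycle⁻ x∈
      ... | t , t≤e , eq = contradiction (vertexAt-cancelˡ (a + 1) z≤n gap≤k (sym eq′)) λ ()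
        where
        shift : a + d + t ≡ a + 1 + (suc c + t)
        shift = trans (+-assoc a d t) (sym (+-assoc a 1 (suc c + t)))
        eq′ : vertexAt (a + 1 + (suc c + t)) ≡ vertexAt (a + 1 + 0)
        eq′ = trans (cong vertexAt (sym shift)) (trans eq (cong vertexAt (sym (+-identityʳ (a + 1)))))
        gap≤k : suc c + t ≤ k
        gap≤k = subst (suc c + t ≤_) (suc-injective d+e≡1+k) (+-monoʳ-≤ (suc c) t≤e)

    orderedChord⇒ChordSplit : ∀ {i j} → toℕ i < toℕ j → Adj (v i) (v j) →
      j ≢ next G i → i ≢ next G j → ChordSplit C
    orderedChord⇒ChordSplit {i} {j} i<j adj j≢i⁺ i≢j⁺
      with gap≥2 i<j (j≢i⁺ ∘ toℕ≡suc⇒≡next)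
         | gap≥2 (≤-trans (toℕ<n j) (m≤n+m (suc k) (toℕ i))) (i≢j⁺ ∘ toℕ+1+k≡suc⇒≡next)
    ... | c , i+d≡j | c′ , j+e≡i+N =
      chordSplit (toℕ i) c (suc (suc c′)) d+e≡N (s≤s (s≤s z≤n)) chord
      where
      N = suc k
      d+e≡N : suc (suc c) + suc (suc c′) ≡ N
      d+e≡N = +-cancelˡ-≡ (toℕ i) _ _ (begin
        toℕ i + (suc (suc c) + suc (suc c′)) ≡⟨ +-assoc (toℕ i) _ _ ⟨
        toℕ i + suc (suc c) + suc (suc c′)   ≡⟨ cong (_+ suc (suc c′)) i+d≡j ⟩
        toℕ j + suc (suc c′)                 ≡⟨ j+e≡i+N ⟩
        toℕ i + N                            ∎)
        where open ≡-Reasoning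
      chord : Adj (vertexAt (toℕ i + suc (suc c))) (vertexAt (toℕ i))
      chord = subst₂ Adj (sym (trans (cong vertexAt i+d≡j) (vertexAt-toℕ j))) (sym (vertexAt-toℕ i))
        (adj-sym adj)

    chord⇒ChordSplit : ∀ i j → Adj (v i) (v j) → j ≢ next G i → i ≢ next G j → ChordSplit C
    chord⇒ChordSplit i j adj j≢i⁺ i≢j⁺ with <-cmp (toℕ i) (toℕ j)
    ... | tri< i<j _ _ = orderedChord⇒ChordSplit i<j adj j≢i⁺ i≢j⁺
    ... | tri≈ _ i≡j _ = contradiction (subst (Adj (v i) ∘ v) (sym (toℕ-injective i≡j)) adj) irrefl
    ... | tri> _ _ j<i = orderedChord⇒ChordSplit j<i (adj-sym adj) i≢j⁺ j≢i⁺

    triangle⇒3≤∣K∩VSet∣ : ∀ {K} → UniqueNonEdgeMaxClique G K → k ≡ 2 → 3 ≤ ∣ K ∩ VSet G C ∣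
    triangle⇒3≤∣K∩VSet∣ {K} unique k≡2 =
      let x∈K , y∈K , z∈K = triangle⊆K unique 0≢1 0≢2 1≢2 (vertexAt-edge 0) (vertexAt-edge 1) closing
      in x,y,z∈p⇒3≤∣p∣ 0≢1 0≢2 1≢2 (on-C 0 x∈K) (on-C 1 y∈K) (on-C 2 z∈K)
      where
      distinct : ∀ {x y} → x ≤ k → y ≤ k → x ≢ y → vertexAt x ≢ vertexAt y
      distinct x≤k y≤k x≢y = x≢y ∘ vertexAt-cancelˡ 0 x≤k y≤k
      1≤k = ≤-trans (s≤s z≤n) 2≤k
      0≢1 = distinct z≤n 1≤k (λ ())
      0≢2 = distinct z≤n 2≤k (λ ())
      1≢2 = distinct 1≤k 2≤k (λ ())
      closing : Adj (vertexAt 0) (vertexAt 2)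
      closing = adj-sym (subst (Adj (vertexAt 2))
        (trans (cong (vertexAt ∘ suc) (sym k≡2)) (vertexAt-periodic 0)) (vertexAt-edge 2))
      on-C : ∀ m → vertexAt m ∈ K → vertexAt m ∈ K ∩ VSet G C
      on-C m ∈K = x∈p∩q⁺ (∈K , VertOf⇒∈VSet C (vertexAt∈C m))

  clique∩hole≤2 : ∀ {S} → IsClique G S → (C : Cycle G) → IsHole G C → ∣ S ∩ VSet G C ∣ ≤ 2
  clique∩hole≤2 {S} S-clique C (3≤k , chordless) with ∣ S ∩ VSet G C ∣ ≤? 2
  ... | yes ≤2 = ≤2
  ... | no ≰2 with m≤∣p∣⇒injection (S ∩ VSet G C) (≰⇒> ≰2)
  ... | f , f-injective , f∈ = ⊥-elim (¬consecutive-triangle 3≤k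
          (distinct (# 0) (# 1) (λ ())) (distinct (# 0) (# 2) (λ ())) (distinct (# 1) (# 2) (λ ()))
          (consecutive (# 0) (# 1) (λ ())) (consecutive (# 0) (# 2) (λ ())) (consecutive (# 1) (# 2) (λ ())))
    where
    open Cycle C
    f∈S : ∀ p → f p ∈ S
    f∈S p = proj₁ (x∈p∩q⁻ S _ (f∈ p))
    f∈C : ∀ p → VertOf G C (f p)
    f∈C p = ∈VSet⇒VertOf C (proj₂ (x∈p∩q⁻ S _ (f∈ p)))
    position : Fin 3 → Fin (suc k)
    position p = proj₁ (f∈C p)
    v-position : ∀ p → v (position p) ≡ f p
    v-position p = proj₂ (f∈C p)
    distinct : ∀ p q → p ≢ q → position p ≢ position q
    distinct p q p≢q eq = p≢q (f-injective (trans (sym (v-position p)) (trans (cong v eq) (v-position q))))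
    consecutive : ∀ p q → p ≢ q → Consecutive (position p) (position q)
    consecutive p q p≢q = chordless (position p) (position q)
      (subst₂ Adj (sym (v-position p)) (sym (v-position q)) (S-clique _ _ (f∈S p) (f∈S q) (p≢q ∘ f-injective)))

  module _ {K : Subset n} (unique : UniqueNonEdgeMaxClique G K) (holes-disjoint : HolesEdgeDisjoint G) where

    meets≤2⇒hole : ∀ f (C : Cycle G) → Cycle.k C ≤ f → ∣ K ∩ VSet G C ∣ ≤ 2 → IsHole G C
    meets≤2⇒hole zero C k≤0 _ = contradiction (≤-trans (Cycle.2≤k C) k≤0) λ ()
    meets≤2⇒hole (suc f) C k≤1+f ≤2 = 3≤k , chordless
      where
      open Cycle C
      open OnCycle C
      3≤k : 3 ≤ k
      3≤k with m≤n⇒m<n∨m≡n 2≤k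
      ... | inj₁ 2<k = 2<k
      ... | inj₂ 2≡k = contradiction ≤2 (<⇒≱ (triangle⇒3≤∣K∩VSet∣ unique (sym 2≡k)))
      shorter-hole : ∀ D → Cycle.k D < k → (∀ x → VertOf G D x → VertOf G C x) → IsHole G D
      shorter-hole D D<C D⊆C =
        meets≤2⇒hole f D (s≤s⁻¹ (≤-trans D<C k≤1+f)) (≤-trans (∣∩VSet∣-mono K C D D⊆C) ≤2)
      ¬split : ChordSplit C → ⊥
      ¬split split = ¬hole-split holes-disjoint split
        (shorter-hole left left-shorter left-⊆) (shorter-hole right right-shorter right-⊆)
        where open ChordSplit split
      chordless : ∀ i j → Adj (v i) (v j) → j ≡ next G i ⊎ i ≡ next G j
      chordless i j adj with j ≟ next G i | i ≟ next G j
      ... | yes j≡i⁺ | _        = inj₁ j≡i⁺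
      ... | no _     | yes i≡j⁺ = inj₂ i≡j⁺
      ... | no j≢i⁺  | no i≢j⁺  = ⊥-elim (¬split (chord⇒ChordSplit i j adj j≢i⁺ i≢j⁺))

lemma2p2 : (n : ℕ) (G : Graph n) → Connected G → HolesEdgeDisjoint G →
    (K : Subset n) → UniqueNonEdgeMaxClique G K →
    (C : Cycle G) → IsHole G C ⇔ ∣ K ∩ VSet G C ∣ ≤ 2
lemma2p2 n G _ holes-disjoint K unique C =
  mk⇔ (clique∩hole≤2 G K-clique C) (meets≤2⇒hole G unique holes-disjoint (Cycle.k C) C ≤-refl)
  where
  K-clique : IsClique G K
  K-clique = proj₁ (proj₁ (proj₁ unique))
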